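{- For any nonempty pattern $P$, there are integers $k_1,\ldots,k_r\ge1$ and vectors $v_1,\ldots,v_r\in\mathbb{Z}^2$, unique up to reordering, such that $\varphi(P)=\bigcup_{i=1}^r (v_i+T_{k_i})$, $\sum_{i=1}^r k_i\le |P|$, and $N(v_i+T_{k_i})\cap (v_j+T_{k_j})=\varnothing$ for all $i\ne j$.
   Context: A pattern is a finite subset $P\subset\mathbb{Z}^2$. Let $T=\{(0,1),(1,1),(1,0)\}$ and, for $n\ge1$, $T_n=\{(a,b)\in\{0,\ldots,n-1\}^2 : a+b\geq n-1\}$. The filling $\varphi(P)$ is obtained from $P$ by repeatedly adding a point $w$ whenever there is $v\in\mathbb{Z}^2$ with $|P\cap(v+T)|=2$ (for the current set) and $w\in v+T$, until no more points can be added. The neighbourhood of a point $x$ is $N(x)=\{x\pm(1,0),\,x\pm(0,1),\,x\pm(1,-1)\}$ (the points that lie in a common translate of $T$ with $x$), and the neighbourhood $N(A)$ of a set $A$ is the union of the neighbourhoods of its points. -}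

module Defs where

open import Data.Nat using (ℕ; zero; suc)
open import Data.Integer using (ℤ; +_; _+_; _-_; -[1+_]; _≤_)
open import Data.Product using (_×_; _,_; ∃-syntax; Σ-syntax)
open import Data.List using (List; []; _∷_; length; lookup; map)
open import Data.Nat.ListAction using (sum)
open import Data.List.Relation.Unary.Any using (Any)
open import Data.List.Relation.Unary.All using (All)
open import Data.List.Relation.Unary.Unique.Propositional using (Unique)
open import Data.List.Relation.Binary.Permutation.Propositional using (_↭_)
open import Data.Fin using (Fin)
open import Relation.Binary.PropositionalEquality using (_≡_; _≢_)
open import Relation.Nullary using (¬_)
open import Data.Nat using () renaming (_≤_ to _≤ₙ_)

Point : Set
Point = ℤ × ℤ

infixl 6 _⊕_
_⊕_ : Point → Point → Point
(a , b) ⊕ (c , d) = (a + c , b + d)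

-- A pattern: a finite subset of ℤ², given as a duplicate-free list,
-- so that its cardinality |P| is the length of the list.
Pattern : Set
Pattern = List Point

-- The filling φ(P): the least superset of P closed under the rule
-- "if two points of a translate v+T are present, add the third",
-- where T = {(0,1),(1,1),(1,0)}.
data InFill (P : Pattern) : Point → Set where
  base   : ∀ {x} → Any (x ≡_) P → InFill P x
  add₀₁  : ∀ v → InFill P (v ⊕ (+ 1 , + 1)) → InFill P (v ⊕ (+ 1 , + 0))
         → InFill P (v ⊕ (+ 0 , + 1))
  add₁₁  : ∀ v → InFill P (v ⊕ (+ 0 , + 1)) → InFill P (v ⊕ (+ 1 , + 0))
         → InFill P (v ⊕ (+ 1 , + 1))
  add₁₀  : ∀ v → InFill P (v ⊕ (+ 0 , + 1)) → InFill P (v ⊕ (+ 1 , + 1))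
         → InFill P (v ⊕ (+ 1 , + 0))

-- A triangle v + T_k is encoded by the pair (k , v).
Triangle : Set
Triangle = ℕ × Point

_∈T_ : Point → Triangle → Set
x ∈T (k , v) = Σ[ a ∈ ℤ ] Σ[ b ∈ ℤ ]
  (x ≡ v ⊕ (a , b)) × (+ 0 ≤ a) × (+ 0 ≤ b)
  × (a + + 1 ≤ + k) × (b + + 1 ≤ + k) × (+ k ≤ a + b + + 1)

data Nbr (x : Point) : Point → Set where
  n₁ : Nbr x (x ⊕ (+ 1 , + 0))
  n₂ : Nbr x (x ⊕ (-[1+ 0 ] , + 0))
  n₃ : Nbr x (x ⊕ (+ 0 , + 1))
  n₄ : Nbr x (x ⊕ (+ 0 , -[1+ 0 ]))
  n₅ : Nbr x (x ⊕ (+ 1 , -[1+ 0 ]))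
  n₆ : Nbr x (x ⊕ (-[1+ 0 ] , + 1))

NbrDisjoint : Triangle → Triangle → Set
NbrDisjoint A B = ¬ (Σ[ x ∈ Point ] Σ[ y ∈ Point ] (x ∈T A) × (y ∈T B) × Nbr x y)

sizes : List Triangle → ℕ
sizes L = sum (map (λ t → Data.Product.proj₁ t) L)
  where import Data.Product

Decomposition : Pattern → List Triangle → Set
Decomposition P L =
    Unique L
  × All (λ t → 1 ≤ₙ Data.Product.proj₁ t) L
  × (∀ x → (InFill P x → Any (x ∈T_) L) × (Any (x ∈T_) L → InFill P x))
  × sizes L ≤ₙ length P
  × (∀ (i j : Fin (length L)) → i ≢ j → NbrDisjoint (lookup L i) (lookup L j))
  where import Data.Product

-- Write v + T_k as {(x , y) | x ≤ X, y ≤ Y, x + y ≥ S} with k = X + Y - S + 1.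
-- Existence: insert the points of P one at a time into a family of pairwise separated
-- triangles contained in φ(P).  A new triangle that is not separated from a member is
-- replaced, together with that member, by the smallest triangle containing both; this
-- hull still lies in φ(P) (it is filled line by line from the two triangles) and is no
-- larger than the two together, so the sizes stay bounded by |P|.  The union of the
-- final family contains P and is closed under the filling rule, because two points of a
-- translate of T are neighbours and hence lie in a common member; so it is φ(P).
-- Uniqueness: in any decomposition, a triangle covered by the members lies inside a
-- single member, since stepping between neighbouring points never changes the member.
-- Applied in both directions, each member of one decomposition is a member of the other.
module Submission where

open import Data.Empty using (⊥-elim)
open import Data.Fin using (Fin; zero; suc)
import Data.Fin as Fin
open import Data.Integer as ℤ using (ℤ; +_; -[1+_]; _+_; _-_; _≤_; _<_; _⊔_; _⊓_; ∣_∣; 0ℤ)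
open import Data.Integer.Properties
  using (≤-refl; ≤-trans; ≤-antisym; ≤-reflexive; +-mono-≤; _≤?_; _<?_; ≮⇒≥; ≰⇒>; i<j⇒suc[i]≤j;
         i≤j⇒0≤j-i; 0≤i-j⇒j≤i; 0≤i⇒+∣i∣≡i; +-identityʳ; +-inverseʳ; +-comm; drop‿+≤+; i≤i+j;
         ⊔-sel; ⊓-sel; i≤i⊔j; i≤j⊔i; i⊓j≤i; i⊓j≤j; ⊔-lub; ⊓-glb)
open import Data.Integer.Tactic.RingSolver using (solve)
open import Data.List using (List; []; _∷_; _++_; length; lookup; map)
open import Data.List.Membership.Propositional using (_∈_; find; lose)
open import Data.List.Membership.Propositional.Properties using (∈-∃++; ∈-lookup)
open import Data.List.Membership.Propositional.Properties.WithK using (unique∧set⇒bag)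
open import Data.List.Relation.Binary.BagAndSetEquality using (∼bag⇒↭)
open import Data.List.Relation.Binary.Permutation.Propositional using (_↭_; ↭⇒↭ₛ)
open import Data.List.Relation.Binary.Permutation.Propositional.Properties
  using (All-resp-↭; Any-resp-↭; ↭-length; shift)
import Data.List.Relation.Binary.Permutation.Propositional.Properties as ↭
import Data.List.Relation.Binary.Permutation.Setoid.Properties as Permutationₛ
open import Data.List.Relation.Unary.All using (All)
import Data.List.Relation.Unary.All as All
open import Data.List.Relation.Unary.All.Properties using (¬Any⇒All¬)
import Data.List.Relation.Unary.All.Properties as Allₚ
open import Data.List.Relation.Unary.AllPairs using (AllPairs)
import Data.List.Relation.Unary.AllPairs as AllPairs
import Data.List.Relation.Unary.AllPairs.Properties as AllPairsₚ
open import Data.List.Relation.Unary.Any using (Any; here; there; any?)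
import Data.List.Relation.Unary.Any as Any
import Data.List.Relation.Unary.Any.Properties as Anyₚ
open import Data.List.Relation.Unary.Unique.Propositional using (Unique)
open import Data.Nat as ℕ using (ℕ; zero; suc; z≤n; s≤s)
open import Data.Nat.ListAction.Properties using (sum-↭)
import Data.Nat.Properties as ℕₚ
open import Data.Product using (Σ-syntax; _×_; _,_; ∃-syntax; proj₁; proj₂)
open import Data.Sum using (_⊎_; inj₁; inj₂)
open import Function.Bundles using (mk⇔)
open import Relation.Binary.PropositionalEquality
  using (_≡_; _≢_; refl; sym; trans; cong; cong₂; subst; setoid; resp₂)
open import Relation.Nullary using (¬_; Dec; yes; no)
open import Relation.Nullary.Decidable using (_×-dec_; map′; True; toWitness)

open import Defs

infixl 6 _⊹_
_⊹_ : ∀ {a b c d : ℤ} → a ≤ b → c ≤ d → a + c ≤ b + d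
_⊹_ = +-mono-≤

-- Linear arithmetic: c ≤ d is read off from a ≤ b (typically a sum of hypotheses)
-- once the slacks b - a and d - c agree as polynomials, which the ring solver checks.
rearrange : ∀ {a b c d : ℤ} → a ≤ b → b - a ≡ d - c → c ≤ d
rearrange a≤b eq = 0≤i-j⇒j≤i (subst (0ℤ ≤_) eq (i≤j⇒0≤j-i a≤b))

≤-ring : ∀ {c d : ℤ} → 0ℤ ≡ d - c → c ≤ d
≤-ring = rearrange (≤-refl {0ℤ})

0≤1 : 0ℤ ≤ + 1
0≤1 = ℤ.+≤+ z≤n

+1≤⇒≤ : ∀ {a b} → a + + 1 ≤ b → a ≤ b
+1≤⇒≤ {a} {b} a+1≤b = rearrange (a+1≤b ⊹ 0≤1) (solve (a ∷ b ∷ []))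

<⇒+1≤ : ∀ {a b} → a < b → a + + 1 ≤ b
<⇒+1≤ {a} {b} a<b = subst (_≤ b) (+-comm (+ 1) a) (i<j⇒suc[i]≤j a<b)

≰⇒+1≤ : ∀ {a b} → ¬ a ≤ b → b + + 1 ≤ a
≰⇒+1≤ a≰b = <⇒+1≤ (≰⇒> a≰b)

ℤ-induction-up : ∀ (Q : ℤ → Set) {i} → Q i → (∀ j → i ≤ j → Q j → Q (j + + 1))
               → ∀ j → i ≤ j → Q j
ℤ-induction-up Q {i} q₀ step j i≤j = subst Q (i+[j-i]≡j (0≤i⇒+∣i∣≡i (i≤j⇒0≤j-i i≤j))) (go ∣ j - i ∣)
  where
  i+[j-i]≡j : ∀ {d} → d ≡ j - i → i + d ≡ j
  i+[j-i]≡j refl = solve (i ∷ j ∷ [])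
  i+d+1≡i+[1+d] : ∀ d → i + d + + 1 ≡ i + (+ 1 + d)
  i+d+1≡i+[1+d] d = solve (i ∷ d ∷ [])
  go : ∀ n → Q (i + + n)
  go zero = subst Q (sym (+-identityʳ i)) q₀
  go (suc n) = subst Q (i+d+1≡i+[1+d] (+ n)) (step (i + + n) (i≤i+j i (+ n)) (go n))

ℤ-induction-down : ∀ (Q : ℤ → Set) {i} → Q i → (∀ j → j + + 1 ≤ i → Q (j + + 1) → Q j)
                 → ∀ j → j ≤ i → Q j
ℤ-induction-down Q {i} q₀ step j j≤i = subst Q (i-[i-j]≡j (0≤i⇒+∣i∣≡i (i≤j⇒0≤j-i j≤i))) (go ∣ i - j ∣)
  where
  i-[i-j]≡j : ∀ {d} → d ≡ i - j → i - d ≡ j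
  i-[i-j]≡j refl = solve (i ∷ j ∷ [])
  i-[1+d]+1≡i-d : ∀ d → i - (+ 1 + d) + + 1 ≡ i - d
  i-[1+d]+1≡i-d d = solve (i ∷ d ∷ [])
  below : ∀ d → 0ℤ ≤ d → i - (+ 1 + d) + + 1 ≤ i
  below d 0≤d = rearrange 0≤d (solve (i ∷ d ∷ []))
  go : ∀ n → Q (i - + n)
  go zero = subst Q (sym (+-identityʳ i)) q₀
  go (suc n) = step (i - + suc n) (below (+ n) (ℤ.+≤+ z≤n)) (subst Q (sym (i-[1+d]+1≡i-d (+ n))) (go n))

ℤ-induction : ∀ (Q : ℤ → Set) {i} → Q i
         → (∀ j → i ≤ j → Q j → Q (j + + 1)) → (∀ j → j + + 1 ≤ i → Q (j + + 1) → Q j)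
         → ∀ j → Q j
ℤ-induction Q {i} q₀ up down j with i ≤? j
... | yes i≤j = ℤ-induction-up Q q₀ up j i≤j
... | no i≰j = ℤ-induction-down Q q₀ down j (+1≤⇒≤ (≰⇒+1≤ i≰j))

-- The triangle v + T_k in corner form: tri X Y S is {(x , y) | x ≤ X, y ≤ Y, S ≤ x + y}.
data Tri : Set where
  tri : (X Y S : ℤ) → Tri

infix 4 _∈△_ _⊑_ _⊆_

_∈△_ : Point → Tri → Set
(x , y) ∈△ tri X Y S = x ≤ X × y ≤ Y × S ≤ x + y

NonEmpty : Tri → Set
NonEmpty (tri X Y S) = S ≤ X + Y

_⊑_ : Tri → Tri → Set
tri X Y S ⊑ tri X′ Y′ S′ = X ≤ X′ × Y ≤ Y′ × S′ ≤ S

⊑-∈△ : ∀ {t u} p → t ⊑ u → p ∈△ t → p ∈△ u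
⊑-∈△ {tri X Y S} {tri X′ Y′ S′} (x , y) (X≤ , Y≤ , ≤S) (x≤ , y≤ , S≤) =
  ≤-trans x≤ X≤ , ≤-trans y≤ Y≤ , ≤-trans ≤S S≤

_⊆_ : Tri → (Point → Set) → Set
t ⊆ F = ∀ p → p ∈△ t → F p

⊑-⊆ : ∀ {t u F} → t ⊑ u → u ⊆ F → t ⊆ F
⊑-⊆ t⊑u u⊆F p p∈t = u⊆F p (⊑-∈△ p t⊑u p∈t)

point : Point → Tri
point (x , y) = tri x y (x + y)

point-NonEmpty : ∀ p → NonEmpty (point p)
point-NonEmpty (x , y) = ≤-refl

point-∈△ : ∀ p → p ∈△ point p
point-∈△ (x , y) = ≤-refl , ≤-refl , ≤-refl

∈△-point : ∀ {p q} → p ∈△ point q → p ≡ q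
∈△-point {x , y} {a , b} (x≤a , y≤b , a+b≤x+y) = cong₂ _,_ (≤-antisym x≤a a≤x) (≤-antisym y≤b b≤y)
  where
  a≤x : a ≤ x
  a≤x = rearrange (a+b≤x+y ⊹ y≤b) (solve (x ∷ y ∷ a ∷ b ∷ []))
  b≤y : b ≤ y
  b≤y = rearrange (a+b≤x+y ⊹ x≤a) (solve (x ∷ y ∷ a ∷ b ∷ []))

-- Closure under the filling rule, with the unit triangle (x , y) + T written out:
-- nw = (x , y + 1), ne = (x + 1 , y + 1), se = (x + 1 , y).
record Closed (F : Point → Set) : Set where
  field
    fill-nw : ∀ x y → F (x + + 1 , y + + 1) → F (x + + 1 , y) → F (x , y + + 1)
    fill-ne : ∀ x y → F (x , y + + 1) → F (x + + 1 , y) → F (x + + 1 , y + + 1)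
    fill-se : ∀ x y → F (x , y + + 1) → F (x + + 1 , y + + 1) → F (x + + 1 , y)

∈△-closed : ∀ t → Closed (_∈△ t)
∈△-closed (tri X Y S) = record
  { fill-nw = λ x y (x+1≤X , y+1≤Y , _) (_ , _ , S≤x+1+y) →
      +1≤⇒≤ x+1≤X , y+1≤Y , rearrange S≤x+1+y (solve (x ∷ y ∷ S ∷ []))
  ; fill-ne = λ x y (_ , y+1≤Y , S≤x+y+1) (x+1≤X , _ , _) →
      x+1≤X , y+1≤Y , rearrange (S≤x+y+1 ⊹ 0≤1) (solve (x ∷ y ∷ S ∷ []))
  ; fill-se = λ x y (_ , y+1≤Y , S≤x+y+1) (x+1≤X , _ , _) →
      x+1≤X , +1≤⇒≤ y+1≤Y , rearrange S≤x+y+1 (solve (x ∷ y ∷ S ∷ []))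
  }

module Extension {F : Point → Set} (closed : Closed F) where
  open Closed closed

  extendʳ : ∀ {X Y S y₀} → tri X Y S ⊆ F → F (X + + 1 , y₀) → S ≤ X + + 1 + y₀ → y₀ ≤ Y
          → tri (X + + 1) Y S ⊆ F
  extendʳ {X} {Y} {S} {y₀} t⊆F q₀ S≤q₀ y₀≤Y (a , b) (a≤X+1 , b≤Y , S≤a+b) with a ≤? X
  ... | yes a≤X = t⊆F (a , b) (a≤X , b≤Y , S≤a+b)
  ... | no a≰X = subst (λ x → F (x , b)) X+1≡a
                   (column b b≤Y (subst (λ x → S ≤ x + b) (sym X+1≡a) S≤a+b))
    where
    X+1≡a : X + + 1 ≡ a
    X+1≡a = ≤-antisym (≰⇒+1≤ a≰X) a≤X+1
    Column : ℤ → Set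
    Column y = y ≤ Y → S ≤ X + + 1 + y → F (X + + 1 , y)
    up : ∀ y → y₀ ≤ y → Column y → Column (y + + 1)
    up y y₀≤y ih y+1≤Y _ =
      fill-ne X y (t⊆F _ (≤-refl , y+1≤Y , rearrange (S≤q₀ ⊹ y₀≤y) (solve (X ∷ y ∷ y₀ ∷ S ∷ []))))
                  (ih (+1≤⇒≤ y+1≤Y) (rearrange (S≤q₀ ⊹ y₀≤y) (solve (X ∷ y ∷ y₀ ∷ S ∷ []))))
    down : ∀ y → y + + 1 ≤ y₀ → Column (y + + 1) → Column y
    down y y+1≤y₀ ih y≤Y S≤X+1+y =
      fill-se X y (t⊆F _ (≤-refl , y+1≤Y , rearrange S≤X+1+y (solve (X ∷ y ∷ S ∷ []))))
                  (ih y+1≤Y (rearrange (S≤X+1+y ⊹ 0≤1) (solve (X ∷ y ∷ S ∷ []))))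
      where
      y+1≤Y : y + + 1 ≤ Y
      y+1≤Y = ≤-trans y+1≤y₀ y₀≤Y
    column : ∀ y → Column y
    column = ℤ-induction Column (λ _ _ → q₀) up down

  extendᵘ : ∀ {X Y S x₀} → tri X Y S ⊆ F → F (x₀ , Y + + 1) → S ≤ x₀ + (Y + + 1) → x₀ ≤ X
          → tri X (Y + + 1) S ⊆ F
  extendᵘ {X} {Y} {S} {x₀} t⊆F q₀ S≤q₀ x₀≤X (a , b) (a≤X , b≤Y+1 , S≤a+b) with b ≤? Y
  ... | yes b≤Y = t⊆F (a , b) (a≤X , b≤Y , S≤a+b)
  ... | no b≰Y = subst (λ y → F (a , y)) Y+1≡b
                   (row a a≤X (subst (λ y → S ≤ a + y) (sym Y+1≡b) S≤a+b))
    where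
    Y+1≡b : Y + + 1 ≡ b
    Y+1≡b = ≤-antisym (≰⇒+1≤ b≰Y) b≤Y+1
    Row : ℤ → Set
    Row x = x ≤ X → S ≤ x + (Y + + 1) → F (x , Y + + 1)
    up : ∀ x → x₀ ≤ x → Row x → Row (x + + 1)
    up x x₀≤x ih x+1≤X _ =
      fill-ne x Y (ih (+1≤⇒≤ x+1≤X) (rearrange (S≤q₀ ⊹ x₀≤x) (solve (x ∷ x₀ ∷ Y ∷ S ∷ []))))
                  (t⊆F _ (x+1≤X , ≤-refl , rearrange (S≤q₀ ⊹ x₀≤x) (solve (x ∷ x₀ ∷ Y ∷ S ∷ []))))
    down : ∀ x → x + + 1 ≤ x₀ → Row (x + + 1) → Row x
    down x x+1≤x₀ ih x≤X S≤x+Y+1 =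
      fill-nw x Y (ih x+1≤X (rearrange (S≤x+Y+1 ⊹ 0≤1) (solve (x ∷ Y ∷ S ∷ []))))
                  (t⊆F _ (x+1≤X , ≤-refl , rearrange S≤x+Y+1 (solve (x ∷ Y ∷ S ∷ []))))
      where
      x+1≤X : x + + 1 ≤ X
      x+1≤X = ≤-trans x+1≤x₀ x₀≤X
    row : ∀ x → Row x
    row = ℤ-induction Row (λ _ _ → q₀) up down

  extendᵈ : ∀ {X Y S x₀ y₀} → tri X Y (S + + 1) ⊆ F → F (x₀ , y₀) → x₀ + y₀ ≡ S → x₀ ≤ X → y₀ ≤ Y
          → tri X Y S ⊆ F
  extendᵈ {X} {Y} {S} {x₀} {y₀} t⊆F q₀ x₀+y₀≡S x₀≤X y₀≤Y (a , b) (a≤X , b≤Y , S≤a+b)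
    with S + + 1 ≤? a + b
  ... | yes S+1≤a+b = t⊆F (a , b) (a≤X , b≤Y , S+1≤a+b)
  ... | no S+1≰a+b = diagonal a a≤X b a+b≡S b≤Y
    where
    a+b≡S : a + b ≡ S
    a+b≡S = ≤-antisym (rearrange (≰⇒+1≤ S+1≰a+b) (solve (a ∷ b ∷ S ∷ []))) S≤a+b
    Diagonal : ℤ → Set
    Diagonal x = x ≤ X → ∀ y → x + y ≡ S → y ≤ Y → F (x , y)
    start : Diagonal x₀
    start _ y x₀+y≡S _ = subst (λ y → F (x₀ , y)) y₀≡y q₀
      where
      y₀≡y : y₀ ≡ y
      y₀≡y = ≤-antisym (rearrange (≤-reflexive (trans x₀+y₀≡S (sym x₀+y≡S))) (solve (x₀ ∷ y ∷ y₀ ∷ [])))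
                       (rearrange (≤-reflexive (trans x₀+y≡S (sym x₀+y₀≡S))) (solve (x₀ ∷ y ∷ y₀ ∷ [])))
    up : ∀ x → x₀ ≤ x → Diagonal x → Diagonal (x + + 1)
    up x x₀≤x ih x+1≤X y x+1+y≡S _ =
      fill-se x y (ih (+1≤⇒≤ x+1≤X) (y + + 1) (trans x+[y+1]≡x+1+y x+1+y≡S) y+1≤Y)
                  (t⊆F (x + + 1 , y + + 1)
                       (x+1≤X , y+1≤Y , rearrange (≤-reflexive (sym x+1+y≡S)) (solve (x ∷ y ∷ S ∷ []))))
      where
      x+[y+1]≡x+1+y : x + (y + + 1) ≡ x + + 1 + y
      x+[y+1]≡x+1+y = solve (x ∷ y ∷ [])
      y+1≤Y : y + + 1 ≤ Y
      y+1≤Y = rearrange (≤-reflexive x+1+y≡S ⊹ ≤-reflexive (sym x₀+y₀≡S) ⊹ x₀≤x ⊹ y₀≤Y)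
                        (solve (x ∷ y ∷ x₀ ∷ y₀ ∷ S ∷ Y ∷ []))
    down : ∀ x → x + + 1 ≤ x₀ → Diagonal (x + + 1) → Diagonal x
    down x x+1≤x₀ ih x≤X y x+y≡S y≤Y =
      subst (λ y → F (x , y)) y-1+1≡y
        (fill-nw x (y - + 1)
          (t⊆F (x + + 1 , y - + 1 + + 1) (x+1≤X , rearrange y≤Y (solve (y ∷ Y ∷ [])) ,
                  rearrange (≤-reflexive (sym x+y≡S)) (solve (x ∷ y ∷ S ∷ []))))
          (ih x+1≤X (y - + 1) (trans x+1+[y-1]≡x+y x+y≡S) (rearrange (y≤Y ⊹ 0≤1) (solve (y ∷ Y ∷ [])))))
      where
      x+1≤X : x + + 1 ≤ X
      x+1≤X = ≤-trans x+1≤x₀ x₀≤X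
      x+1+[y-1]≡x+y : x + + 1 + (y - + 1) ≡ x + y
      x+1+[y-1]≡x+y = solve (x ∷ y ∷ [])
      y-1+1≡y : y - + 1 + + 1 ≡ y
      y-1+1≡y = solve (y ∷ [])
    diagonal : ∀ x → Diagonal x
    diagonal = ℤ-induction Diagonal start up down

record MergeConditions (X₁ Y₁ S₁ X₂ Y₂ S₂ : ℤ) : Set where
  constructor merge-conditions
  field
    S₁≤X₁+Y₂+1 : S₁ ≤ X₁ + Y₂ + + 1
    S₁≤X₂+Y₁+1 : S₁ ≤ X₂ + Y₁ + + 1
    S₁≤X₂+Y₂+1 : S₁ ≤ X₂ + Y₂ + + 1
    S₂≤X₁+Y₁+1 : S₂ ≤ X₁ + Y₁ + + 1
    S₂≤X₁+Y₂+1 : S₂ ≤ X₁ + Y₂ + + 1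
    S₂≤X₂+Y₁+1 : S₂ ≤ X₂ + Y₁ + + 1

-- Two points are mergeable iff they are equal or neighbours, and the smallest
-- triangle containing two mergeable triangles is no larger than the two together.
Mergeable : Tri → Tri → Set
Mergeable (tri X₁ Y₁ S₁) (tri X₂ Y₂ S₂) = MergeConditions X₁ Y₁ S₁ X₂ Y₂ S₂

mergeable? : ∀ A B → Dec (Mergeable A B)
mergeable? (tri X₁ Y₁ S₁) (tri X₂ Y₂ S₂) =
  map′ (λ (a , b , c , d , e , f) → merge-conditions a b c d e f)
       (λ (merge-conditions a b c d e f) → a , b , c , d , e , f)
       (S₁ ≤? X₁ + Y₂ + + 1 ×-dec S₁ ≤? X₂ + Y₁ + + 1 ×-dec S₁ ≤? X₂ + Y₂ + + 1 ×-dec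
        S₂ ≤? X₁ + Y₁ + + 1 ×-dec S₂ ≤? X₁ + Y₂ + + 1 ×-dec S₂ ≤? X₂ + Y₁ + + 1)

Mergeable-sym : ∀ A B → Mergeable A B → Mergeable B A
Mergeable-sym (tri _ _ _) (tri _ _ _) (merge-conditions a b c d e f) = merge-conditions f e d c b a

Mergeable-refl : ∀ {A} → NonEmpty A → Mergeable A A
Mergeable-refl {tri X Y S} S≤X+Y = merge-conditions S≤ S≤ S≤ S≤ S≤ S≤
  where
  S≤ : S ≤ X + Y + + 1
  S≤ = rearrange (S≤X+Y ⊹ 0≤1) (solve (X ∷ Y ∷ S ∷ []))

Mergeable-mono : ∀ {A A′ B B′} → A ⊑ A′ → B ⊑ B′ → Mergeable A B → Mergeable A′ B′
Mergeable-mono {tri X₁ Y₁ S₁} {tri X₁′ Y₁′ S₁′} {tri X₂ Y₂ S₂} {tri X₂′ Y₂′ S₂′}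
  (x₁ , y₁ , s₁) (x₂ , y₂ , s₂) (merge-conditions a b c d e f) =
  merge-conditions (grow s₁ x₁ y₂ a) (grow s₁ x₂ y₁ b) (grow s₁ x₂ y₂ c)
                   (grow s₂ x₁ y₁ d) (grow s₂ x₁ y₂ e) (grow s₂ x₂ y₁ f)
  where
  grow : ∀ {S S′ X X′ Y Y′} → S′ ≤ S → X ≤ X′ → Y ≤ Y′ → S ≤ X + Y + + 1 → S′ ≤ X′ + Y′ + + 1
  grow {S} {S′} {X} {X′} {Y} {Y′} S′≤S X≤X′ Y≤Y′ S≤ =
    rearrange (S′≤S ⊹ S≤ ⊹ X≤X′ ⊹ Y≤Y′) (solve (S ∷ S′ ∷ X ∷ X′ ∷ Y ∷ Y′ ∷ []))

hull : Tri → Tri → Tri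
hull (tri X₁ Y₁ S₁) (tri X₂ Y₂ S₂) = tri (X₁ ⊔ X₂) (Y₁ ⊔ Y₂) (S₁ ⊓ S₂)

⊑-hullˡ : ∀ A B → A ⊑ hull A B
⊑-hullˡ (tri X₁ Y₁ S₁) (tri X₂ Y₂ S₂) = i≤i⊔j X₁ X₂ , i≤i⊔j Y₁ Y₂ , i⊓j≤i S₁ S₂

⊑-hullʳ : ∀ A B → B ⊑ hull A B
⊑-hullʳ (tri X₁ Y₁ S₁) (tri X₂ Y₂ S₂) = i≤j⊔i X₁ X₂ , i≤j⊔i Y₁ Y₂ , i⊓j≤j S₁ S₂

hull-NonEmpty : ∀ A B → NonEmpty A → NonEmpty (hull A B)
hull-NonEmpty (tri X₁ Y₁ S₁) (tri X₂ Y₂ S₂) S₁≤X₁+Y₁ =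
  ≤-trans (i⊓j≤i S₁ S₂) (≤-trans S₁≤X₁+Y₁ (i≤i⊔j X₁ X₂ ⊹ i≤i⊔j Y₁ Y₂))

-- The size of tri X Y S is X + Y - S + 1; excess is that minus one.
excess : Tri → ℤ
excess (tri X Y S) = X + Y - S

excess-hull : ∀ A B → NonEmpty A → NonEmpty B → Mergeable A B
            → excess (hull A B) ≤ excess A + excess B + + 1
excess-hull (tri X₁ Y₁ S₁) (tri X₂ Y₂ S₂) nA nB (merge-conditions m₁ m₂ m₃ m₄ m₅ m₆)
  with ⊔-sel X₁ X₂ | ⊔-sel Y₁ Y₂ | ⊓-sel S₁ S₂
... | inj₁ x | inj₁ y | inj₁ s rewrite x | y | s = rearrange (nB ⊹ 0≤1) (solve (X₁ ∷ Y₁ ∷ S₁ ∷ X₂ ∷ Y₂ ∷ S₂ ∷ []))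
... | inj₁ x | inj₁ y | inj₂ s rewrite x | y | s = rearrange m₃ (solve (X₁ ∷ Y₁ ∷ S₁ ∷ X₂ ∷ Y₂ ∷ S₂ ∷ []))
... | inj₁ x | inj₂ y | inj₁ s rewrite x | y | s = rearrange m₆ (solve (X₁ ∷ Y₁ ∷ S₁ ∷ X₂ ∷ Y₂ ∷ S₂ ∷ []))
... | inj₁ x | inj₂ y | inj₂ s rewrite x | y | s = rearrange m₂ (solve (X₁ ∷ Y₁ ∷ S₁ ∷ X₂ ∷ Y₂ ∷ S₂ ∷ []))
... | inj₂ x | inj₁ y | inj₁ s rewrite x | y | s = rearrange m₅ (solve (X₁ ∷ Y₁ ∷ S₁ ∷ X₂ ∷ Y₂ ∷ S₂ ∷ []))
... | inj₂ x | inj₁ y | inj₂ s rewrite x | y | s = rearrange m₁ (solve (X₁ ∷ Y₁ ∷ S₁ ∷ X₂ ∷ Y₂ ∷ S₂ ∷ []))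
... | inj₂ x | inj₂ y | inj₁ s rewrite x | y | s = rearrange m₄ (solve (X₁ ∷ Y₁ ∷ S₁ ∷ X₂ ∷ Y₂ ∷ S₂ ∷ []))
... | inj₂ x | inj₂ y | inj₂ s rewrite x | y | s = rearrange (nA ⊹ 0≤1) (solve (X₁ ∷ Y₁ ∷ S₁ ∷ X₂ ∷ Y₂ ∷ S₂ ∷ []))

NonEmpty⇒0≤excess : ∀ {A} → NonEmpty A → 0ℤ ≤ excess A
NonEmpty⇒0≤excess {tri X Y S} = i≤j⇒0≤j-i

+1≤1+⇒≤ : ∀ {a b} → a + + 1 ≤ + 1 + b → a ≤ b
+1≤1+⇒≤ {a} {b} a+1≤1+b = rearrange a+1≤1+b (solve (a ∷ b ∷ []))

0≤⇒+1≰0 : ∀ {a} → 0ℤ ≤ a → ¬ (a + + 1 ≤ 0ℤ)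
0≤⇒+1≰0 {a} 0≤a a+1≤0 = 1≰0 (rearrange (0≤a ⊹ a+1≤0) (solve (a ∷ [])))
  where
  1≰0 : ¬ (+ 1 ≤ 0ℤ)
  1≰0 (ℤ.+≤+ ())

module Merging {F : Point → Set} (closed : Closed F) where
  open Extension closed

  -- Induction on the excess of B: cut B down by the line on which it sticks out of A
  -- (right, top or diagonal), and refill that line from the smaller hull with extendʳ,
  -- extendᵘ or extendᵈ.  If B is a single point, mergeability puts it next to A.
  HullsBelow : Tri → Tri → Set
  HullsBelow A B = ∀ {B′} → B′ ⊑ B → excess B′ + + 1 ≤ excess B → NonEmpty B′ → Mergeable A B′
                 → hull A B′ ⊆ F

  hull-⊆ʳ : ∀ {X₁ Y₁ S₁ X₂ Y₂ S₂} → X₁ + + 1 ≤ X₂ → S₁ ≤ X₁ + Y₁ → S₂ ≤ X₂ + Y₂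
          → tri X₁ Y₁ S₁ ⊆ F → tri X₂ Y₂ S₂ ⊆ F → MergeConditions X₁ Y₁ S₁ X₂ Y₂ S₂
          → HullsBelow (tri X₁ Y₁ S₁) (tri X₂ Y₂ S₂) → hull (tri X₁ Y₁ S₁) (tri X₂ Y₂ S₂) ⊆ F
  hull-⊆ʳ {X₁} {Y₁} {S₁} {X₂} {Y₂} {S₂} X₁+1≤X₂ nA nB A⊆F B⊆F (merge-conditions m₁ m₂ m₃ m₄ m₅ m₆) below =
    ⊑-⊆ (⊔-lub X₁≤X₂-1+1 X₂≤X₂-1+1 , ≤-refl , ≤-refl)
        (extendʳ inner (B⊆F (X₂ - + 1 + + 1 , Y₂) (X₂-1+1≤X₂ , ≤-refl , rearrange nB (solve (X₂ ∷ Y₂ ∷ S₂ ∷ []))))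
                 (≤-trans (i⊓j≤j S₁ S₂) (rearrange nB (solve (X₂ ∷ Y₂ ∷ S₂ ∷ [])))) (i≤j⊔i Y₁ Y₂))
    where
    X₁≤X₂-1+1 : X₁ ≤ X₂ - + 1 + + 1
    X₁≤X₂-1+1 = rearrange (X₁+1≤X₂ ⊹ 0≤1) (solve (X₁ ∷ X₂ ∷ []))
    X₂≤X₂-1+1 : X₂ ≤ X₂ - + 1 + + 1
    X₂≤X₂-1+1 = ≤-ring (solve (X₂ ∷ []))
    X₂-1+1≤X₂ : X₂ - + 1 + + 1 ≤ X₂
    X₂-1+1≤X₂ = ≤-ring (solve (X₂ ∷ []))
    shrinks : X₂ - + 1 + Y₂ - S₂ + + 1 ≤ X₂ + Y₂ - S₂
    shrinks = ≤-ring (solve (X₂ ∷ Y₂ ∷ S₂ ∷ []))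
    inner : tri (X₂ - + 1) (Y₁ ⊔ Y₂) (S₁ ⊓ S₂) ⊆ F
    inner with S₂ + + 1 ≤? X₂ + Y₂
    ... | yes S₂+1≤X₂+Y₂ =
      ⊑-⊆ (i≤j⊔i X₁ (X₂ - + 1) , ≤-refl , ≤-refl)
          (below {tri (X₂ - + 1) Y₂ S₂} (rearrange 0≤1 (solve (X₂ ∷ [])) , ≤-refl , ≤-refl) shrinks
                 (rearrange S₂+1≤X₂+Y₂ (solve (X₂ ∷ Y₂ ∷ S₂ ∷ [])))
                 (merge-conditions m₁ (rearrange (nA ⊹ X₁+1≤X₂ ⊹ 0≤1) (solve (X₁ ∷ Y₁ ∷ S₁ ∷ X₂ ∷ [])))
                    (rearrange (m₁ ⊹ X₁+1≤X₂) (solve (X₁ ∷ S₁ ∷ X₂ ∷ Y₂ ∷ [])))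
                    m₄ m₅ (rearrange (m₄ ⊹ X₁+1≤X₂) (solve (X₁ ∷ Y₁ ∷ X₂ ∷ S₂ ∷ [])))))
    ... | no S₂+1≰X₂+Y₂ = ⊑-⊆ (X₂-1≤X₁ , ⊔-lub ≤-refl Y₂≤Y₁ , ⊓-glb ≤-refl S₁≤S₂) A⊆F
      where
      B-point : X₂ + Y₂ ≤ S₂
      B-point = rearrange (≰⇒+1≤ S₂+1≰X₂+Y₂) (solve (X₂ ∷ Y₂ ∷ S₂ ∷ []))
      X₂-1≤X₁ : X₂ - + 1 ≤ X₁
      X₂-1≤X₁ = rearrange (m₅ ⊹ B-point) (solve (X₁ ∷ X₂ ∷ Y₂ ∷ S₂ ∷ []))
      Y₂≤Y₁ : Y₂ ≤ Y₁
      Y₂≤Y₁ = rearrange (m₄ ⊹ B-point ⊹ X₁+1≤X₂) (solve (X₁ ∷ Y₁ ∷ X₂ ∷ Y₂ ∷ S₂ ∷ []))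
      S₁≤S₂ : S₁ ≤ S₂
      S₁≤S₂ = rearrange (m₁ ⊹ X₁+1≤X₂ ⊹ B-point) (solve (X₁ ∷ S₁ ∷ X₂ ∷ Y₂ ∷ S₂ ∷ []))

  hull-⊆ᵘ : ∀ {X₁ Y₁ S₁ X₂ Y₂ S₂} → Y₁ + + 1 ≤ Y₂ → S₁ ≤ X₁ + Y₁ → S₂ ≤ X₂ + Y₂
          → tri X₁ Y₁ S₁ ⊆ F → tri X₂ Y₂ S₂ ⊆ F → MergeConditions X₁ Y₁ S₁ X₂ Y₂ S₂
          → HullsBelow (tri X₁ Y₁ S₁) (tri X₂ Y₂ S₂) → hull (tri X₁ Y₁ S₁) (tri X₂ Y₂ S₂) ⊆ F
  hull-⊆ᵘ {X₁} {Y₁} {S₁} {X₂} {Y₂} {S₂} Y₁+1≤Y₂ nA nB A⊆F B⊆F (merge-conditions m₁ m₂ m₃ m₄ m₅ m₆) below =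
    ⊑-⊆ (≤-refl , ⊔-lub Y₁≤Y₂-1+1 Y₂≤Y₂-1+1 , ≤-refl)
        (extendᵘ inner (B⊆F (X₂ , Y₂ - + 1 + + 1) (≤-refl , Y₂-1+1≤Y₂ , rearrange nB (solve (X₂ ∷ Y₂ ∷ S₂ ∷ []))))
                 (≤-trans (i⊓j≤j S₁ S₂) (rearrange nB (solve (X₂ ∷ Y₂ ∷ S₂ ∷ [])))) (i≤j⊔i X₁ X₂))
    where
    Y₁≤Y₂-1+1 : Y₁ ≤ Y₂ - + 1 + + 1
    Y₁≤Y₂-1+1 = rearrange (Y₁+1≤Y₂ ⊹ 0≤1) (solve (Y₁ ∷ Y₂ ∷ []))
    Y₂≤Y₂-1+1 : Y₂ ≤ Y₂ - + 1 + + 1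
    Y₂≤Y₂-1+1 = ≤-ring (solve (Y₂ ∷ []))
    Y₂-1+1≤Y₂ : Y₂ - + 1 + + 1 ≤ Y₂
    Y₂-1+1≤Y₂ = ≤-ring (solve (Y₂ ∷ []))
    shrinks : X₂ + (Y₂ - + 1) - S₂ + + 1 ≤ X₂ + Y₂ - S₂
    shrinks = ≤-ring (solve (X₂ ∷ Y₂ ∷ S₂ ∷ []))
    inner : tri (X₁ ⊔ X₂) (Y₂ - + 1) (S₁ ⊓ S₂) ⊆ F
    inner with S₂ + + 1 ≤? X₂ + Y₂
    ... | yes S₂+1≤X₂+Y₂ =
      ⊑-⊆ (≤-refl , i≤j⊔i Y₁ (Y₂ - + 1) , ≤-refl)
          (below {tri X₂ (Y₂ - + 1) S₂} (≤-refl , rearrange 0≤1 (solve (Y₂ ∷ [])) , ≤-refl) shrinks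
                 (rearrange S₂+1≤X₂+Y₂ (solve (X₂ ∷ Y₂ ∷ S₂ ∷ [])))
                 (merge-conditions (rearrange (nA ⊹ Y₁+1≤Y₂ ⊹ 0≤1) (solve (X₁ ∷ Y₁ ∷ S₁ ∷ Y₂ ∷ [])))
                    m₂ (rearrange (m₂ ⊹ Y₁+1≤Y₂) (solve (Y₁ ∷ S₁ ∷ X₂ ∷ Y₂ ∷ [])))
                    m₄ (rearrange (m₄ ⊹ Y₁+1≤Y₂) (solve (X₁ ∷ Y₁ ∷ Y₂ ∷ S₂ ∷ []))) m₆))
    ... | no S₂+1≰X₂+Y₂ = ⊑-⊆ (⊔-lub ≤-refl X₂≤X₁ , Y₂-1≤Y₁ , ⊓-glb ≤-refl S₁≤S₂) A⊆F
      where
      B-point : X₂ + Y₂ ≤ S₂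
      B-point = rearrange (≰⇒+1≤ S₂+1≰X₂+Y₂) (solve (X₂ ∷ Y₂ ∷ S₂ ∷ []))
      X₂≤X₁ : X₂ ≤ X₁
      X₂≤X₁ = rearrange (m₄ ⊹ B-point ⊹ Y₁+1≤Y₂) (solve (X₁ ∷ Y₁ ∷ X₂ ∷ Y₂ ∷ S₂ ∷ []))
      Y₂-1≤Y₁ : Y₂ - + 1 ≤ Y₁
      Y₂-1≤Y₁ = rearrange (m₆ ⊹ B-point) (solve (Y₁ ∷ X₂ ∷ Y₂ ∷ S₂ ∷ []))
      S₁≤S₂ : S₁ ≤ S₂
      S₁≤S₂ = rearrange (m₂ ⊹ Y₁+1≤Y₂ ⊹ B-point) (solve (Y₁ ∷ S₁ ∷ X₂ ∷ Y₂ ∷ S₂ ∷ []))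

  hull-⊆ᵈ : ∀ {X₁ Y₁ S₁ X₂ Y₂ S₂} → X₂ ≤ X₁ → Y₂ ≤ Y₁ → S₂ + + 1 ≤ S₁ → S₁ ≤ X₁ + Y₁ → S₂ ≤ X₂ + Y₂
          → tri X₁ Y₁ S₁ ⊆ F → tri X₂ Y₂ S₂ ⊆ F → MergeConditions X₁ Y₁ S₁ X₂ Y₂ S₂
          → HullsBelow (tri X₁ Y₁ S₁) (tri X₂ Y₂ S₂) → hull (tri X₁ Y₁ S₁) (tri X₂ Y₂ S₂) ⊆ F
  hull-⊆ᵈ {X₁} {Y₁} {S₁} {X₂} {Y₂} {S₂} X₂≤X₁ Y₂≤Y₁ S₂+1≤S₁ nA nB A⊆F B⊆F
          (merge-conditions m₁ m₂ m₃ m₄ m₅ m₆) below =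
    ⊑-⊆ (≤-refl , ≤-refl , ⊓-glb (+1≤⇒≤ S₂+1≤S₁) ≤-refl)
        (extendᵈ inner (B⊆F (X₂ , S₂ - X₂) (≤-refl , S₂-X₂≤Y₂ , ≤-ring (solve (X₂ ∷ S₂ ∷ []))))
                 X₂+[S₂-X₂]≡S₂ (i≤j⊔i X₁ X₂) (≤-trans S₂-X₂≤Y₂ (i≤j⊔i Y₁ Y₂)))
    where
    S₂-X₂≤Y₂ : S₂ - X₂ ≤ Y₂
    S₂-X₂≤Y₂ = rearrange nB (solve (X₂ ∷ Y₂ ∷ S₂ ∷ []))
    X₂+[S₂-X₂]≡S₂ : X₂ + (S₂ - X₂) ≡ S₂
    X₂+[S₂-X₂]≡S₂ = solve (X₂ ∷ S₂ ∷ [])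
    shrinks : X₂ + Y₂ - (S₂ + + 1) + + 1 ≤ X₂ + Y₂ - S₂
    shrinks = ≤-ring (solve (X₂ ∷ Y₂ ∷ S₂ ∷ []))
    inner : tri (X₁ ⊔ X₂) (Y₁ ⊔ Y₂) (S₂ + + 1) ⊆ F
    inner with S₂ + + 1 ≤? X₂ + Y₂
    ... | yes S₂+1≤X₂+Y₂ =
      ⊑-⊆ (≤-refl , ≤-refl , i⊓j≤j S₁ (S₂ + + 1))
          (below {tri X₂ Y₂ (S₂ + + 1)} (≤-refl , ≤-refl , rearrange 0≤1 (solve (S₂ ∷ []))) shrinks S₂+1≤X₂+Y₂
                 (merge-conditions m₁ m₂ m₃
                    (rearrange (S₂+1≤S₁ ⊹ nA ⊹ 0≤1) (solve (X₁ ∷ Y₁ ∷ S₁ ∷ S₂ ∷ [])))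
                    (rearrange (S₂+1≤S₁ ⊹ m₁) (solve (X₁ ∷ S₁ ∷ Y₂ ∷ S₂ ∷ [])))
                    (rearrange (S₂+1≤S₁ ⊹ m₂) (solve (Y₁ ∷ S₁ ∷ X₂ ∷ S₂ ∷ [])))))
    ... | no S₂+1≰X₂+Y₂ = ⊑-⊆ (⊔-lub ≤-refl X₂≤X₁ , ⊔-lub ≤-refl Y₂≤Y₁ , S₁≤S₂+1) A⊆F
      where
      B-point : X₂ + Y₂ ≤ S₂
      B-point = rearrange (≰⇒+1≤ S₂+1≰X₂+Y₂) (solve (X₂ ∷ Y₂ ∷ S₂ ∷ []))
      S₁≤S₂+1 : S₁ ≤ S₂ + + 1
      S₁≤S₂+1 = rearrange (m₃ ⊹ B-point) (solve (S₁ ∷ X₂ ∷ Y₂ ∷ S₂ ∷ []))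

  hull-⊆-bounded : ∀ n {A B} → excess B ≤ + n → NonEmpty A → NonEmpty B → A ⊆ F → B ⊆ F → Mergeable A B
                 → hull A B ⊆ F
  hulls-below : ∀ n {A B} → excess B ≤ + n → NonEmpty A → A ⊆ F → B ⊆ F → HullsBelow A B

  hull-⊆-bounded n {tri X₁ Y₁ S₁} {tri X₂ Y₂ S₂} e≤n nA nB A⊆F B⊆F m with X₁ <? X₂ | Y₁ <? Y₂ | S₂ <? S₁
  ... | yes X₁<X₂ | _ | _ = hull-⊆ʳ (<⇒+1≤ X₁<X₂) nA nB A⊆F B⊆F m (hulls-below n e≤n nA A⊆F B⊆F)
  ... | no _ | yes Y₁<Y₂ | _ = hull-⊆ᵘ (<⇒+1≤ Y₁<Y₂) nA nB A⊆F B⊆F m (hulls-below n e≤n nA A⊆F B⊆F)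
  ... | no X₁≮X₂ | no Y₁≮Y₂ | yes S₂<S₁ =
    hull-⊆ᵈ (≮⇒≥ X₁≮X₂) (≮⇒≥ Y₁≮Y₂) (<⇒+1≤ S₂<S₁) nA nB A⊆F B⊆F m (hulls-below n e≤n nA A⊆F B⊆F)
  ... | no X₁≮X₂ | no Y₁≮Y₂ | no S₂≮S₁ =
    ⊑-⊆ (⊔-lub ≤-refl (≮⇒≥ X₁≮X₂) , ⊔-lub ≤-refl (≮⇒≥ Y₁≮Y₂) , ⊓-glb ≤-refl (≮⇒≥ S₂≮S₁)) A⊆F

  hulls-below zero e≤0 _ _ _ {B′} _ e′+1≤e nB′ _ =
    ⊥-elim (0≤⇒+1≰0 (NonEmpty⇒0≤excess {B′} nB′) (≤-trans e′+1≤e e≤0))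
  hulls-below (suc n) e≤n nA A⊆F B⊆F B′⊑B e′+1≤e nB′ m′ =
    hull-⊆-bounded n (+1≤1+⇒≤ (≤-trans e′+1≤e e≤n)) nA nB′ A⊆F (⊑-⊆ B′⊑B B⊆F) m′

  hull-⊆ : ∀ {A B} → NonEmpty A → NonEmpty B → A ⊆ F → B ⊆ F → Mergeable A B → hull A B ⊆ F
  hull-⊆ {B = B} nA nB =
    hull-⊆-bounded ∣ excess B ∣ (≤-reflexive (sym (0≤i⇒+∣i∣≡i (NonEmpty⇒0≤excess {B} nB)))) nA nB

Adjacent : Point → Point → Set
Adjacent p q = Mergeable (point p) (point q)

∈△-⊑ : ∀ {p t} → p ∈△ t → point p ⊑ t
∈△-⊑ {_ , _} {tri _ _ _} p∈t = p∈t

Adjacent⇒Mergeable : ∀ {p q A B} → p ∈△ A → q ∈△ B → Adjacent p q → Mergeable A B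
Adjacent⇒Mergeable p∈A q∈B = Mergeable-mono (∈△-⊑ p∈A) (∈△-⊑ q∈B)

-- Whether x and x ⊕ d are adjacent depends on d only, so it is decided at (0 , 0).
Adjacent-offset : ∀ x d → {True (mergeable? (point (0ℤ , 0ℤ)) (point d))} → Adjacent x (x ⊕ d)
Adjacent-offset (x₁ , x₂) (d₁ , d₂) {d-adjacent} with toWitness d-adjacent
... | merge-conditions a b c d e f =
  merge-conditions (rearrange a (solve (x₁ ∷ x₂ ∷ d₁ ∷ d₂ ∷ []))) (rearrange b (solve (x₁ ∷ x₂ ∷ d₁ ∷ d₂ ∷ [])))
                   (rearrange c (solve (x₁ ∷ x₂ ∷ d₁ ∷ d₂ ∷ []))) (rearrange d (solve (x₁ ∷ x₂ ∷ d₁ ∷ d₂ ∷ [])))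
                   (rearrange e (solve (x₁ ∷ x₂ ∷ d₁ ∷ d₂ ∷ []))) (rearrange f (solve (x₁ ∷ x₂ ∷ d₁ ∷ d₂ ∷ [])))

Nbr⇒Adjacent : ∀ {x y} → Nbr x y → Adjacent x y
Nbr⇒Adjacent {x} n₁ = Adjacent-offset x _
Nbr⇒Adjacent {x} n₂ = Adjacent-offset x _
Nbr⇒Adjacent {x} n₃ = Adjacent-offset x _
Nbr⇒Adjacent {x} n₄ = Adjacent-offset x _
Nbr⇒Adjacent {x} n₅ = Adjacent-offset x _
Nbr⇒Adjacent {x} n₆ = Adjacent-offset x _

∈△-small-close : ∀ {X Y S a₁ a₂ b₁ b₂} → X + Y - S ≤ + 1 → (a₁ , a₂) ∈△ tri X Y S → (b₁ , b₂) ∈△ tri X Y S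
               → a₁ + a₂ ≤ a₁ + b₂ + + 1 × a₁ + a₂ ≤ b₁ + a₂ + + 1 × a₁ + a₂ ≤ b₁ + b₂ + + 1
∈△-small-close {X} {Y} {S} {a₁} {a₂} {b₁} {b₂} small (a₁≤X , a₂≤Y , _) (b₁≤X , b₂≤Y , S≤b₁+b₂) =
  rearrange (a₂≤Y ⊹ S≤b₁+b₂ ⊹ b₁≤X ⊹ small) (solve (X ∷ Y ∷ S ∷ a₁ ∷ a₂ ∷ b₁ ∷ b₂ ∷ [])) ,
  rearrange (a₁≤X ⊹ S≤b₁+b₂ ⊹ b₂≤Y ⊹ small) (solve (X ∷ Y ∷ S ∷ a₁ ∷ a₂ ∷ b₁ ∷ b₂ ∷ [])) ,
  rearrange (a₁≤X ⊹ a₂≤Y ⊹ S≤b₁+b₂ ⊹ small) (solve (X ∷ Y ∷ S ∷ a₁ ∷ a₂ ∷ b₁ ∷ b₂ ∷ []))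

∈△-small⇒Adjacent : ∀ {t p q} → excess t ≤ + 1 → p ∈△ t → q ∈△ t → Adjacent p q
∈△-small⇒Adjacent {tri _ _ _} {_ , _} {_ , _} small p∈t q∈t
  with ∈△-small-close small p∈t q∈t | ∈△-small-close small q∈t p∈t
... | a , b , c | f , e , d = merge-conditions a b c d e f

corner : Triangle → Tri
corner (k , (v₁ , v₂)) = tri (v₁ + + k - + 1) (v₂ + + k - + 1) (v₁ + v₂ + + k - + 1)

toTriangle : Tri → Triangle
toTriangle (tri X Y S) = suc ∣ X + Y - S ∣ , (S - Y , S - X)

-- The ring solver only abstracts variables, so + k is generalised to K below.
∈T⇒∈△ : ∀ {x} t → x ∈T t → x ∈△ corner t
∈T⇒∈△ (k , (v₁ , v₂)) (a , b , refl , _ , _ , a+1≤k , b+1≤k , k≤a+b+1) = go (+ k) a+1≤k b+1≤k k≤a+b+1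
  where
  go : ∀ K → a + + 1 ≤ K → b + + 1 ≤ K → K ≤ a + b + + 1
     → (v₁ + a , v₂ + b) ∈△ tri (v₁ + K - + 1) (v₂ + K - + 1) (v₁ + v₂ + K - + 1)
  go K a+1≤K b+1≤K K≤a+b+1 =
    rearrange a+1≤K (solve (v₁ ∷ a ∷ K ∷ [])) , rearrange b+1≤K (solve (v₂ ∷ b ∷ K ∷ [])) ,
    rearrange K≤a+b+1 (solve (v₁ ∷ v₂ ∷ a ∷ b ∷ K ∷ []))

∈△⇒∈T : ∀ {x} t → x ∈△ corner t → x ∈T t
∈△⇒∈T {x₁ , x₂} (k , (v₁ , v₂)) x∈ = go (+ k) x∈
  where
  go : ∀ K → (x₁ , x₂) ∈△ tri (v₁ + K - + 1) (v₂ + K - + 1) (v₁ + v₂ + K - + 1)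
     → Σ[ a ∈ ℤ ] Σ[ b ∈ ℤ ] ((x₁ , x₂) ≡ (v₁ , v₂) ⊕ (a , b)) × (+ 0 ≤ a) × (+ 0 ≤ b)
                             × (a + + 1 ≤ K) × (b + + 1 ≤ K) × (K ≤ a + b + + 1)
  go K (x₁≤ , x₂≤ , S≤) =
    x₁ - v₁ , x₂ - v₂ , cong₂ _,_ (solve (x₁ ∷ v₁ ∷ [])) (solve (x₂ ∷ v₂ ∷ [])) ,
    rearrange (S≤ ⊹ x₂≤) (solve (x₁ ∷ x₂ ∷ v₁ ∷ v₂ ∷ K ∷ [])) ,
    rearrange (S≤ ⊹ x₁≤) (solve (x₁ ∷ x₂ ∷ v₁ ∷ v₂ ∷ K ∷ [])) ,
    rearrange x₁≤ (solve (x₁ ∷ v₁ ∷ K ∷ [])) , rearrange x₂≤ (solve (x₂ ∷ v₂ ∷ K ∷ [])) ,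
    rearrange S≤ (solve (x₁ ∷ x₂ ∷ v₁ ∷ v₂ ∷ K ∷ []))

tri-≡ : ∀ {X Y S X′ Y′ S′} → X ≡ X′ → Y ≡ Y′ → S ≡ S′ → tri X Y S ≡ tri X′ Y′ S′
tri-≡ refl refl refl = refl

corner-toTriangle : ∀ {t} → NonEmpty t → corner (toTriangle t) ≡ t
corner-toTriangle {tri X Y S} S≤X+Y =
  trans (cong (λ K → tri (S - Y + K - + 1) (S - X + K - + 1) (S - Y + (S - X) + K - + 1)) K≡)
        (tri-≡ (solve (X ∷ Y ∷ S ∷ [])) (solve (X ∷ Y ∷ S ∷ [])) (solve (X ∷ Y ∷ S ∷ [])))
  where
  K≡ : + suc ∣ X + Y - S ∣ ≡ + 1 + (X + Y - S)
  K≡ = cong (λ e → + 1 + e) (0≤i⇒+∣i∣≡i (i≤j⇒0≤j-i S≤X+Y))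

corner-NonEmpty : ∀ k v → NonEmpty (corner (suc k , v))
corner-NonEmpty k (v₁ , v₂) = go (+ k) (ℤ.+≤+ z≤n)
  where
  go : ∀ m → 0ℤ ≤ m → NonEmpty (tri (v₁ + (+ 1 + m) - + 1) (v₂ + (+ 1 + m) - + 1) (v₁ + v₂ + (+ 1 + m) - + 1))
  go m 0≤m = rearrange 0≤m (solve (v₁ ∷ v₂ ∷ m ∷ []))

toTriangle-corner : ∀ k v → toTriangle (corner (suc k , v)) ≡ (suc k , v)
toTriangle-corner k (v₁ , v₂) = go (+ k)
  where
  go : ∀ m → toTriangle (tri (v₁ + (+ 1 + m) - + 1) (v₂ + (+ 1 + m) - + 1) (v₁ + v₂ + (+ 1 + m) - + 1))
           ≡ (suc ∣ m ∣ , (v₁ , v₂))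
  go m = cong₂ _,_ (cong (λ e → suc ∣ e ∣) excess≡m)
                   (cong₂ _,_ (solve (v₁ ∷ v₂ ∷ m ∷ [])) (solve (v₁ ∷ v₂ ∷ m ∷ [])))
    where
    excess≡m : v₁ + (+ 1 + m) - + 1 + (v₂ + (+ 1 + m) - + 1) - (v₁ + v₂ + (+ 1 + m) - + 1) ≡ m
    excess≡m = solve (v₁ ∷ v₂ ∷ m ∷ [])

∈△⇒∈T-toTriangle : ∀ {x t} → NonEmpty t → x ∈△ t → x ∈T toTriangle t
∈△⇒∈T-toTriangle {x} {t} nt x∈t = ∈△⇒∈T (toTriangle t) (subst (x ∈△_) (sym (corner-toTriangle nt)) x∈t)

∈T-toTriangle⇒∈△ : ∀ {x t} → NonEmpty t → x ∈T toTriangle t → x ∈△ t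
∈T-toTriangle⇒∈△ {x} {t} nt x∈t = subst (x ∈△_) (corner-toTriangle nt) (∈T⇒∈△ (toTriangle t) x∈t)

toTriangle-injective : ∀ {t u} → NonEmpty t → NonEmpty u → toTriangle t ≡ toTriangle u → t ≡ u
toTriangle-injective nt nu eq =
  trans (sym (corner-toTriangle nt)) (trans (cong corner eq) (corner-toTriangle nu))

InFill-closed : ∀ P → Closed (InFill P)
InFill-closed P = record
  { fill-nw = λ x y ne se → subst (λ a → InFill P (a , y + + 1)) (+-identityʳ x)
                              (add₀₁ (x , y) ne (subst (λ b → InFill P (x + + 1 , b)) (sym (+-identityʳ y)) se))
  ; fill-ne = λ x y nw se → add₁₁ (x , y) (subst (λ a → InFill P (a , y + + 1)) (sym (+-identityʳ x)) nw)
                              (subst (λ b → InFill P (x + + 1 , b)) (sym (+-identityʳ y)) se)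
  ; fill-se = λ x y nw ne → subst (λ b → InFill P (x + + 1 , b)) (+-identityʳ y)
                              (add₁₀ (x , y) (subst (λ a → InFill P (a , y + + 1)) (sym (+-identityʳ x)) nw) ne)
  }

InFill-least : ∀ {P G} → Closed G → (∀ {x} → Any (x ≡_) P → G x) → ∀ {x} → InFill P x → G x
InFill-least closed P⊆G (base x∈P) = P⊆G x∈P
InFill-least {G = G} closed P⊆G (add₀₁ (x , y) ne se) =
  subst (λ a → G (a , y + + 1)) (sym (+-identityʳ x))
    (fill-nw x y (InFill-least closed P⊆G ne)
                 (subst (λ b → G (x + + 1 , b)) (+-identityʳ y) (InFill-least closed P⊆G se)))
  where open Closed closed
InFill-least {G = G} closed P⊆G (add₁₁ (x , y) nw se) =
  fill-ne x y (subst (λ a → G (a , y + + 1)) (+-identityʳ x) (InFill-least closed P⊆G nw))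
              (subst (λ b → G (x + + 1 , b)) (+-identityʳ y) (InFill-least closed P⊆G se))
  where open Closed closed
InFill-least {G = G} closed P⊆G (add₁₀ (x , y) nw ne) =
  subst (λ b → G (x + + 1 , b)) (sym (+-identityʳ y))
    (fill-se x y (subst (λ a → G (a , y + + 1)) (+-identityʳ x) (InFill-least closed P⊆G nw))
                 (InFill-least closed P⊆G ne))
  where open Closed closed

Separated : Tri → Tri → Set
Separated A B = ¬ Mergeable A B

Separated-sym : ∀ {A B} → Separated A B → Separated B A
Separated-sym {A} {B} sep m = sep (Mergeable-sym B A m)

common-triangle : ∀ {L p q} → AllPairs Separated L → Any (p ∈△_) L → Any (q ∈△_) L → Adjacent p q
                → Any (λ t → p ∈△ t × q ∈△ t) L
common-triangle _ (here p∈t) (here q∈t) _ = here (p∈t , q∈t)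
common-triangle (sep AllPairs.∷ _) (here p∈t) (there q∈L) adj with All.lookupAny sep q∈L
... | t∤u , q∈u = ⊥-elim (t∤u (Adjacent⇒Mergeable p∈t q∈u adj))
common-triangle (sep AllPairs.∷ _) (there p∈L) (here q∈t) adj with All.lookupAny sep p∈L
... | t∤u , p∈u = ⊥-elim (t∤u (Adjacent⇒Mergeable q∈t p∈u (Mergeable-sym (point _) (point _) adj)))
common-triangle (_ AllPairs.∷ seps) (there p∈L) (there q∈L) adj = there (common-triangle seps p∈L q∈L adj)

unit : ℤ → ℤ → Tri
unit x y = tri (x + + 1) (y + + 1) (x + y + + 1)

module _ (x y : ℤ) where
  nw∈unit : (x , y + + 1) ∈△ unit x y
  nw∈unit = rearrange 0≤1 (solve (x ∷ [])) , ≤-refl , ≤-ring (solve (x ∷ y ∷ []))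

  ne∈unit : (x + + 1 , y + + 1) ∈△ unit x y
  ne∈unit = ≤-refl , ≤-refl , rearrange 0≤1 (solve (x ∷ y ∷ []))

  se∈unit : (x + + 1 , y) ∈△ unit x y
  se∈unit = ≤-refl , rearrange 0≤1 (solve (y ∷ [])) , ≤-ring (solve (x ∷ y ∷ []))

  unit-small : excess (unit x y) ≤ + 1
  unit-small = excess≤1
    where
    excess≤1 : x + + 1 + (y + + 1) - (x + y + + 1) ≤ + 1
    excess≤1 = ≤-ring (solve (x ∷ y ∷ []))

Covered : List Tri → Point → Set
Covered L p = Any (p ∈△_) L

Covered-closed : ∀ {L} → AllPairs Separated L → Closed (Covered L)
Covered-closed seps = record
  { fill-nw = λ x y ne se → Any.map (λ {t} (ne∈t , se∈t) → Closed.fill-nw (∈△-closed t) x y ne∈t se∈t)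
                              (common-triangle seps ne se (adjacent x y (ne∈unit x y) (se∈unit x y)))
  ; fill-ne = λ x y nw se → Any.map (λ {t} (nw∈t , se∈t) → Closed.fill-ne (∈△-closed t) x y nw∈t se∈t)
                              (common-triangle seps nw se (adjacent x y (nw∈unit x y) (se∈unit x y)))
  ; fill-se = λ x y nw ne → Any.map (λ {t} (nw∈t , ne∈t) → Closed.fill-se (∈△-closed t) x y nw∈t ne∈t)
                              (common-triangle seps nw ne (adjacent x y (nw∈unit x y) (ne∈unit x y)))
  }
  where
  adjacent : ∀ x y {p q} → p ∈△ unit x y → q ∈△ unit x y → Adjacent p q
  adjacent x y = ∈△-small⇒Adjacent (unit-small x y)

record Packing (F : Point → Set) (L : List Tri) : Set where
  field
    nonEmpty : All NonEmpty L
    inside : All (_⊆ F) L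
    separated : AllPairs Separated L
open Packing

AllPairs-resp-↭ : ∀ {A : Set} {R : A → A → Set} {xs ys} → (∀ {x y} → R x y → R y x)
                → xs ↭ ys → AllPairs R xs → AllPairs R ys
AllPairs-resp-↭ {A} {R} R-sym xs↭ys = Permutationₛ.AllPairs-resp-↭ (setoid A) R-sym (resp₂ R) (↭⇒↭ₛ xs↭ys)

Packing-resp-↭ : ∀ {F L L′} → L ↭ L′ → Packing F L → Packing F L′
Packing-resp-↭ L↭L′ pk = record
  { nonEmpty = All-resp-↭ L↭L′ (nonEmpty pk)
  ; inside = All-resp-↭ L↭L′ (inside pk)
  ; separated = AllPairs-resp-↭ Separated-sym L↭L′ (separated pk)
  }

Packing-tail : ∀ {F u L} → Packing F (u ∷ L) → Packing F L
Packing-tail pk = record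
  { nonEmpty = All.tail (nonEmpty pk) ; inside = All.tail (inside pk) ; separated = AllPairs.tail (separated pk) }

find-mergeable : ∀ t L → All (Separated t) L ⊎ (Σ[ u ∈ Tri ] Σ[ rest ∈ List Tri ] Mergeable t u × L ↭ u ∷ rest)
find-mergeable t L with any? (mergeable? t) L
... | no ¬any = inj₁ (¬Any⇒All¬ L ¬any)
... | yes any with find any
...   | u , u∈L , m with ∈-∃++ u∈L
...     | ys , zs , refl = inj₂ (u , ys ++ zs , m , shift u ys zs)

size : Tri → ℕ
size t = proj₁ (toTriangle t)

totalSize : List Tri → ℕ
totalSize L = sizes (map toTriangle L)

size-point : ∀ q → size (point q) ≡ 1
size-point (x , y) = cong (λ e → suc ∣ e ∣) (+-inverseʳ (x + y))

size-hull : ∀ A B → NonEmpty A → NonEmpty B → Mergeable A B → size (hull A B) ℕ.≤ size A ℕ.+ size B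
size-hull A@(tri _ _ _) B@(tri _ _ _) nA nB m =
  suc-∣∣-≤ (NonEmpty⇒0≤excess {hull A B} (hull-NonEmpty A B nA)) (NonEmpty⇒0≤excess {A} nA)
           (NonEmpty⇒0≤excess {B} nB) (excess-hull A B nA nB m)
  where
  suc-∣∣-≤ : ∀ {h a b} → 0ℤ ≤ h → 0ℤ ≤ a → 0ℤ ≤ b → h ≤ a + b + + 1 → suc ∣ h ∣ ℕ.≤ suc ∣ a ∣ ℕ.+ suc ∣ b ∣
  suc-∣∣-≤ (ℤ.+≤+ _) (ℤ.+≤+ {n = m} _) (ℤ.+≤+ {n = n} _) h≤ =
    s≤s (ℕₚ.≤-trans (drop‿+≤+ h≤) (ℕₚ.≤-reflexive (trans (ℕₚ.+-assoc m n 1) (cong (m ℕ.+_) (ℕₚ.+-comm n 1)))))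

module Insertion {F : Point → Set} (closed : Closed F) where
  open Merging closed

  record Inserted (t : Tri) (L : List Tri) : Set where
    field
      result : List Tri
      packing : Packing F result
      covers : ∀ {p} → p ∈△ t ⊎ Any (p ∈△_) L → Any (p ∈△_) result
      bounded : totalSize result ℕ.≤ size t ℕ.+ totalSize L

  insert : ∀ n t L → length L ℕ.≤ n → NonEmpty t → t ⊆ F → Packing F L → Inserted t L
  insert n t L len nt t⊆F pk with find-mergeable t L
  ... | inj₁ t-separated = record
    { result = t ∷ L
    ; packing = record { nonEmpty = nt All.∷ nonEmpty pk ; inside = t⊆F All.∷ inside pk
                       ; separated = t-separated AllPairs.∷ separated pk }
    ; covers = λ { (inj₁ p∈t) → here p∈t ; (inj₂ p∈L) → there p∈L }
    ; bounded = ℕₚ.≤-refl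
    }
  ... | inj₂ (u , rest , m , L↭u∷rest) = merge n len
    where
    pk′ : Packing F (u ∷ rest)
    pk′ = Packing-resp-↭ L↭u∷rest pk
    nu : NonEmpty u
    nu = All.head (nonEmpty pk′)
    u⊆F : u ⊆ F
    u⊆F = All.head (inside pk′)
    length-L : length L ≡ suc (length rest)
    length-L = ↭-length L↭u∷rest
    total-L : totalSize L ≡ size u ℕ.+ totalSize rest
    total-L = sum-↭ (↭.map⁺ proj₁ (↭.map⁺ toTriangle L↭u∷rest))
    merge : ∀ n → length L ℕ.≤ n → Inserted t L
    merge zero len with ℕₚ.≤-trans (ℕₚ.≤-reflexive (sym length-L)) len
    ... | ()
    merge (suc n) len = record
      { result = Inserted.result r
      ; packing = Inserted.packing r
      ; covers = covers
      ; bounded = ℕₚ.≤-trans (Inserted.bounded r)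
                    (ℕₚ.≤-trans (ℕₚ.+-monoˡ-≤ (totalSize rest) (size-hull t u nt nu m))
                      (ℕₚ.≤-reflexive (trans (ℕₚ.+-assoc (size t) (size u) (totalSize rest))
                                             (cong (size t ℕ.+_) (sym total-L)))))
      }
      where
      r : Inserted (hull t u) rest
      r = insert n (hull t u) rest (ℕₚ.≤-pred (ℕₚ.≤-trans (ℕₚ.≤-reflexive (sym length-L)) len))
                 (hull-NonEmpty t u nt) (hull-⊆ nt nu t⊆F u⊆F m) (Packing-tail pk′)
      covers : ∀ {p} → p ∈△ t ⊎ Any (p ∈△_) L → Any (p ∈△_) (Inserted.result r)
      covers {p} (inj₁ p∈t) = Inserted.covers r (inj₁ (⊑-∈△ p (⊑-hullˡ t u) p∈t))
      covers {p} (inj₂ p∈L) with Any-resp-↭ L↭u∷rest p∈L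
      ... | here p∈u = Inserted.covers r (inj₁ (⊑-∈△ p (⊑-hullʳ t u) p∈u))
      ... | there p∈rest = Inserted.covers r (inj₂ p∈rest)

  pack : (Q : List Point) → (∀ {p} → Any (p ≡_) Q → F p)
       → Σ[ L ∈ List Tri ] Packing F L × (∀ {p} → Any (p ≡_) Q → Any (p ∈△_) L) × totalSize L ℕ.≤ length Q
  pack [] _ = [] , record { nonEmpty = All.[] ; inside = All.[] ; separated = AllPairs.[] } , (λ ()) , z≤n
  pack (q ∷ Q) Q⊆F with pack Q (λ p∈Q → Q⊆F (there p∈Q))
  ... | L , pk , covers , bounded =
    Inserted.result r , Inserted.packing r , covers′ ,
    ℕₚ.≤-trans (Inserted.bounded r)
               (subst (λ k → k ℕ.+ totalSize L ℕ.≤ suc (length Q)) (sym (size-point q)) (s≤s bounded))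
    where
    r : Inserted (point q) L
    r = insert (length L) (point q) L ℕₚ.≤-refl (point-NonEmpty q)
               (λ p p∈q → subst F (sym (∈△-point p∈q)) (Q⊆F (here refl))) pk
    covers′ : ∀ {p} → Any (p ≡_) (q ∷ Q) → Any (p ∈△_) (Inserted.result r)
    covers′ (here refl) = Inserted.covers r (inj₁ (point-∈△ q))
    covers′ (there p∈Q) = Inserted.covers r (inj₂ (covers p∈Q))

AllPairs-mapWithAll : ∀ {A : Set} {P : A → Set} {R S : A → A → Set} {xs}
                    → (∀ {x y} → P x → P y → R x y → S x y) → All P xs → AllPairs R xs → AllPairs S xs
AllPairs-mapWithAll f All.[] AllPairs.[] = AllPairs.[]
AllPairs-mapWithAll f (px All.∷ pxs) (rx AllPairs.∷ rxs) =
  All.zipWith (λ (py , r) → f px py r) (pxs , rx) AllPairs.∷ AllPairs-mapWithAll f pxs rxs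

AllPairs-lookup : ∀ {A : Set} {R : A → A → Set} {xs} → AllPairs (λ x y → R x y × R y x) xs
                → ∀ i j → i ≢ j → R (lookup xs i) (lookup xs j)
AllPairs-lookup (_ AllPairs.∷ _) zero zero i≢j = ⊥-elim (i≢j refl)
AllPairs-lookup (r AllPairs.∷ _) zero (suc j) _ = proj₁ (All.lookup r (∈-lookup j))
AllPairs-lookup (r AllPairs.∷ _) (suc i) zero _ = proj₂ (All.lookup r (∈-lookup i))
AllPairs-lookup (_ AllPairs.∷ rs) (suc i) (suc j) i≢j = AllPairs-lookup rs i j (λ i≡j → i≢j (cong suc i≡j))

Separated⇒toTriangle-≢ : ∀ {A B} → NonEmpty A → NonEmpty B → Separated A B → toTriangle A ≢ toTriangle B
Separated⇒toTriangle-≢ {A} nA nB sep eq =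
  sep (subst (Mergeable A) (toTriangle-injective nA nB eq) (Mergeable-refl nA))

Separated⇒NbrDisjoint : ∀ {A B} → NonEmpty A → NonEmpty B → Separated A B
                      → NbrDisjoint (toTriangle A) (toTriangle B)
Separated⇒NbrDisjoint nA nB sep (x , y , x∈A , y∈B , x~y) =
  sep (Adjacent⇒Mergeable (∈T-toTriangle⇒∈△ nA x∈A) (∈T-toTriangle⇒∈△ nB y∈B) (Nbr⇒Adjacent x~y))

decomposition : ∀ P → Σ[ L ∈ List Triangle ] Decomposition P L
decomposition P with Insertion.pack (InFill-closed P) P base
... | L , pk , P⊆L , bounded =
  map toTriangle L , unique , positive , (λ _ → fill⊆ , ⊆fill) , bounded ,
  AllPairs-lookup {R = NbrDisjoint} (AllPairsₚ.map⁺ (AllPairs-mapWithAll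
    (λ nA nB sep → Separated⇒NbrDisjoint nA nB sep , Separated⇒NbrDisjoint nB nA (Separated-sym sep))
    (nonEmpty pk) (separated pk)))
  where
  unique : Unique (map toTriangle L)
  unique = AllPairsₚ.map⁺ (AllPairs-mapWithAll Separated⇒toTriangle-≢ (nonEmpty pk) (separated pk))
  positive : All (λ t → 1 ℕ.≤ proj₁ t) (map toTriangle L)
  positive = Allₚ.map⁺ (All.universal (λ { (tri _ _ _) → s≤s z≤n }) L)
  fill⊆ : ∀ {x} → InFill P x → Any (x ∈T_) (map toTriangle L)
  fill⊆ x∈fill with find (InFill-least (Covered-closed (separated pk)) P⊆L x∈fill)
  ... | t , t∈L , x∈t = Anyₚ.map⁺ (lose t∈L (∈△⇒∈T-toTriangle (All.lookup (nonEmpty pk) t∈L) x∈t))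
  ⊆fill : ∀ {x} → Any (x ∈T_) (map toTriangle L) → InFill P x
  ⊆fill x∈L with find (Anyₚ.map⁻ x∈L)
  ... | t , t∈L , x∈t = All.lookup (inside pk) t∈L _ (∈T-toTriangle⇒∈△ (All.lookup (nonEmpty pk) t∈L) x∈t)

Nbr-right : ∀ x y → Nbr (x , y) (x + + 1 , y)
Nbr-right x y = subst (λ b → Nbr (x , y) (x + + 1 , b)) (+-identityʳ y) n₁

Nbr-up : ∀ x y → Nbr (x , y) (x , y + + 1)
Nbr-up x y = subst (λ a → Nbr (x , y) (a , y + + 1)) (+-identityʳ x) n₃

neighbour-in : ∀ {x X Y S} → x ∈△ tri X Y S → S + + 1 ≤ X + Y → Σ[ y ∈ Point ] y ∈△ tri X Y S × Nbr x y
neighbour-in {x₁ , x₂} {X} {Y} {S} (x₁≤X , x₂≤Y , S≤x₁+x₂) S+1≤X+Y with x₁ + + 1 ≤? X | x₂ + + 1 ≤? Y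
... | yes x₁+1≤X | _ =
  (x₁ + + 1 , x₂ + + 0) ,
  (x₁+1≤X , rearrange x₂≤Y (solve (x₂ ∷ Y ∷ [])) , rearrange (S≤x₁+x₂ ⊹ 0≤1) (solve (x₁ ∷ x₂ ∷ S ∷ []))) , n₁
... | no _ | yes x₂+1≤Y =
  (x₁ + + 0 , x₂ + + 1) ,
  (rearrange x₁≤X (solve (x₁ ∷ X ∷ [])) , x₂+1≤Y , rearrange (S≤x₁+x₂ ⊹ 0≤1) (solve (x₁ ∷ x₂ ∷ S ∷ []))) , n₃
... | no x₁+1≰X | no x₂+1≰Y =
  (x₁ + -[1+ 0 ] , x₂ + + 0) ,
  (rearrange (x₁≤X ⊹ 0≤1) (solve (x₁ ∷ X ∷ [])) , rearrange x₂≤Y (solve (x₂ ∷ Y ∷ [])) ,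
       rearrange (S+1≤X+Y ⊹ ≰⇒+1≤ x₁+1≰X ⊹ ≰⇒+1≤ x₂+1≰Y) (solve (x₁ ∷ x₂ ∷ X ∷ Y ∷ S ∷ []))) , n₂

∈△-point-triangle : ∀ {z X Y S} → X + Y ≤ S → z ∈△ tri X Y S → z ≡ (X , Y)
∈△-point-triangle {z₁ , z₂} {X} {Y} {S} X+Y≤S (z₁≤X , z₂≤Y , S≤z₁+z₂) =
  cong₂ _,_ (≤-antisym z₁≤X (rearrange (X+Y≤S ⊹ S≤z₁+z₂ ⊹ z₂≤Y) (solve (z₁ ∷ z₂ ∷ X ∷ Y ∷ S ∷ []))))
            (≤-antisym z₂≤Y (rearrange (X+Y≤S ⊹ S≤z₁+z₂ ⊹ z₁≤X) (solve (z₁ ∷ z₂ ∷ X ∷ Y ∷ S ∷ []))))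

no-neighbour⇒singleton : ∀ {x t} → x ∈△ t → (∀ {y} → Nbr x y → ¬ y ∈△ t) → ∀ {z} → z ∈△ t → z ≡ x
no-neighbour⇒singleton {x} {tri X Y S} x∈t lonely z∈t with S + + 1 ≤? X + Y
... | no S+1≰X+Y = trans (∈△-point-triangle X+Y≤S z∈t) (sym (∈△-point-triangle X+Y≤S x∈t))
  where
  X+Y≤S : X + Y ≤ S
  X+Y≤S = rearrange (≰⇒+1≤ S+1≰X+Y) (solve (X ∷ Y ∷ S ∷ []))
... | yes S+1≤X+Y with neighbour-in x∈t S+1≤X+Y
...   | _ , y∈t , x~y = ⊥-elim (lonely x~y y∈t)

⊆⇒⊑ : ∀ {t u} → NonEmpty t → (∀ {z} → z ∈△ t → z ∈△ u) → t ⊑ u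
⊆⇒⊑ {tri X Y S} {tri X′ Y′ S′} S≤X+Y t⊆u with t⊆u (≤-refl , ≤-refl , S≤X+Y) | t⊆u {X , S - X} edge
  where
  edge : (X , S - X) ∈△ tri X Y S
  edge = ≤-refl , rearrange S≤X+Y (solve (X ∷ Y ∷ S ∷ [])) , ≤-ring (solve (X ∷ S ∷ []))
... | X≤X′ , Y≤Y′ , _ | _ , _ , S′≤X+[S-X] = X≤X′ , Y≤Y′ , rearrange S′≤X+[S-X] (solve (X ∷ S ∷ S′ ∷ []))

⊑-antisym : ∀ {t u} → t ⊑ u → u ⊑ t → t ≡ u
⊑-antisym {tri _ _ _} {tri _ _ _} (X≤ , Y≤ , ≤S) (≤X , ≤Y , S≤) =
  tri-≡ (≤-antisym X≤ ≤X) (≤-antisym Y≤ ≤Y) (≤-antisym S≤ ≤S)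

Triangle-ext : ∀ {t u} → 1 ℕ.≤ proj₁ t → 1 ℕ.≤ proj₁ u → (∀ {z} → z ∈T t → z ∈T u) → (∀ {z} → z ∈T u → z ∈T t)
             → t ≡ u
Triangle-ext {suc k , v} {suc k′ , w} (s≤s z≤n) (s≤s z≤n) t⊆u u⊆t =
  trans (sym (toTriangle-corner k v))
        (trans (cong toTriangle (⊑-antisym (⊆⇒⊑ (corner-NonEmpty k v) (⊆-corner (suc k , v) (suc k′ , w) t⊆u))
                                            (⊆⇒⊑ (corner-NonEmpty k′ w) (⊆-corner (suc k′ , w) (suc k , v) u⊆t))))
               (toTriangle-corner k′ w))
  where
  ⊆-corner : ∀ a b → (∀ {z} → z ∈T a → z ∈T b) → ∀ {z} → z ∈△ corner a → z ∈△ corner b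
  ⊆-corner a b a⊆b z∈a = ∈T⇒∈△ b (a⊆b (∈△⇒∈T a z∈a))

NonEmpty⇒∈△ : ∀ t → NonEmpty t → Σ[ x ∈ Point ] x ∈△ t
NonEmpty⇒∈△ (tri X Y S) S≤X+Y = (X , Y) , ≤-refl , ≤-refl , S≤X+Y

some-point : ∀ t → 1 ℕ.≤ proj₁ t → Σ[ x ∈ Point ] x ∈T t
some-point t@(suc k , v) (s≤s z≤n) with NonEmpty⇒∈△ (corner t) (corner-NonEmpty k v)
... | x , x∈t = x , ∈△⇒∈T t x∈t

lookup-injective : ∀ {A : Set} {xs : List A} → Unique xs → ∀ i j → lookup xs i ≡ lookup xs j → i ≡ j
lookup-injective (_ AllPairs.∷ _) zero zero _ = refl
lookup-injective (x∉ AllPairs.∷ _) zero (suc j) eq = ⊥-elim (All.lookup x∉ (∈-lookup j) eq)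
lookup-injective (x∉ AllPairs.∷ _) (suc i) zero eq = ⊥-elim (All.lookup x∉ (∈-lookup i) (sym eq))
lookup-injective (_ AllPairs.∷ xs-unique) (suc i) (suc j) eq = cong suc (lookup-injective xs-unique i j eq)

module DecompositionProperties {P : Pattern} {E : List Triangle} (d : Decomposition P E) where
  unique : Unique E
  unique = proj₁ d
  positive : ∀ i → 1 ℕ.≤ proj₁ (lookup E i)
  positive i = All.lookup (proj₁ (proj₂ d)) (∈-lookup i)
  fill-≡ : ∀ x → (InFill P x → Any (x ∈T_) E) × (Any (x ∈T_) E → InFill P x)
  fill-≡ = proj₁ (proj₂ (proj₂ d))
  disjoint : ∀ i j → i ≢ j → NbrDisjoint (lookup E i) (lookup E j)
  disjoint = proj₂ (proj₂ (proj₂ (proj₂ d)))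

  neighbours-same-index : ∀ {x y i j} → x ∈T lookup E i → y ∈T lookup E j → Nbr x y → i ≡ j
  neighbours-same-index {i = i} {j} x∈ y∈ x~y with i Fin.≟ j
  ... | yes i≡j = i≡j
  ... | no i≢j = ⊥-elim (disjoint i j i≢j (_ , _ , x∈ , y∈ , x~y))

  shared-point-same-index : ∀ {x i l} → x ∈T lookup E i → x ∈T lookup E l → i ≡ l
  shared-point-same-index {x} {i} {l} x∈i x∈l with i Fin.≟ l
  ... | yes i≡l = i≡l
  ... | no i≢l = lookup-injective unique i l
    (Triangle-ext (positive i) (positive l)
       (λ z∈i → subst (_∈T lookup E l) (sym (sole-point i l i≢l x∈i x∈l z∈i)) x∈l)
       (λ z∈l → subst (_∈T lookup E i) (sym (sole-point l i (λ l≡i → i≢l (sym l≡i)) x∈l x∈i z∈l)) x∈i))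
    where
    -- Both triangles contain x, so neither contains a neighbour of x.
    sole-point : ∀ a b → a ≢ b → x ∈T lookup E a → x ∈T lookup E b → ∀ {z} → z ∈T lookup E a → z ≡ x
    sole-point a b a≢b x∈a x∈b z∈a =
      no-neighbour⇒singleton (∈T⇒∈△ (lookup E a) x∈a)
        (λ {y} x~y y∈a → disjoint b a (λ b≡a → a≢b (sym b≡a)) (x , y , x∈b , ∈△⇒∈T (lookup E a) y∈a , x~y))
        (∈T⇒∈△ (lookup E a) z∈a)

  -- Walk from the corner down the last column, then along each row: neighbouring
  -- points always lie in the same member.
  within-one : ∀ t → NonEmpty t → (∀ {p} → p ∈△ t → Any (p ∈T_) E)
             → Σ[ j ∈ Fin (length E) ] (∀ {p} → p ∈△ t → p ∈T lookup E j)
  within-one (tri X Y S) S≤X+Y covered = Any.index (covered corner∈) , λ {p} → row p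
    where
    corner∈ : (X , Y) ∈△ tri X Y S
    corner∈ = ≤-refl , ≤-refl , S≤X+Y
    j₀ : Fin (length E)
    j₀ = Any.index (covered corner∈)
    InE : Point → Set
    InE p = p ∈△ tri X Y S → p ∈T lookup E j₀
    joins : ∀ {p q} → Nbr p q → p ∈△ tri X Y S → q ∈△ tri X Y S → InE q → p ∈T lookup E j₀
    joins p~q p∈t q∈t q∈E = subst (λ i → _ ∈T lookup E i)
      (neighbours-same-index (Anyₚ.lookup-index (covered p∈t)) (q∈E q∈t) p~q) (Anyₚ.lookup-index (covered p∈t))
    column : ∀ y → y ≤ Y → InE (X , y)
    column = ℤ-induction-down (λ y → InE (X , y)) (λ _ → Anyₚ.lookup-index (covered corner∈)) step
      where
      step : ∀ y → y + + 1 ≤ Y → InE (X , y + + 1) → InE (X , y)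
      step y y+1≤Y ih X,y∈t@(_ , _ , S≤X+y) =
        joins (Nbr-up X y) X,y∈t (≤-refl , y+1≤Y , rearrange (S≤X+y ⊹ 0≤1) (solve (X ∷ y ∷ S ∷ []))) ih
    row : ∀ p → InE p
    row (x , y) p∈t@(x≤X , y≤Y , _) = ℤ-induction-down (λ a → InE (a , y)) (column y y≤Y) step x x≤X p∈t
      where
      step : ∀ a → a + + 1 ≤ X → InE (a + + 1 , y) → InE (a , y)
      step a a+1≤X ih a,y∈t@(_ , _ , S≤a+y) =
        joins (Nbr-right a y) a,y∈t (a+1≤X , y≤Y , rearrange (S≤a+y ⊹ 0≤1) (solve (a ∷ y ∷ S ∷ []))) ih

  within-one-Triangle : ∀ {t} → 1 ℕ.≤ proj₁ t → (∀ {p} → p ∈T t → Any (p ∈T_) E)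
                      → Σ[ j ∈ Fin (length E) ] (∀ {p} → p ∈T t → p ∈T lookup E j)
  within-one-Triangle {t@(suc k , v)} (s≤s z≤n) covered
    with within-one (corner t) (corner-NonEmpty k v) (λ p∈ → covered (∈△⇒∈T t p∈))
  ... | j , inside = j , λ p∈ → inside (∈T⇒∈△ t p∈)

-- Each member s of D lies in a member Eⱼ of E, which lies in a member of D; as the
-- latter shares a point with s, it is s itself, so s = Eⱼ.
⊆-decomposition : ∀ {P D E} → Decomposition P D → Decomposition P E → ∀ {t} → t ∈ D → t ∈ E
⊆-decomposition {P} {D} {E} dD dE t∈D = lose (∈-lookup j) (trans (Anyₚ.lookup-index t∈D) s≡Eⱼ)
  where
  module D = DecompositionProperties dD
  module E = DecompositionProperties dE
  i : Fin (length D)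
  i = Any.index t∈D
  s : Triangle
  s = lookup D i
  D⊆E : ∀ {p} → Any (p ∈T_) D → Any (p ∈T_) E
  D⊆E p∈D = proj₁ (E.fill-≡ _) (proj₂ (D.fill-≡ _) p∈D)
  E⊆D : ∀ {p} → Any (p ∈T_) E → Any (p ∈T_) D
  E⊆D p∈E = proj₁ (D.fill-≡ _) (proj₂ (E.fill-≡ _) p∈E)
  s-in-E : Σ[ j ∈ Fin (length E) ] (∀ {p} → p ∈T s → p ∈T lookup E j)
  s-in-E = E.within-one-Triangle {s} (D.positive i) (λ p∈s → D⊆E (lose (∈-lookup i) p∈s))
  j : Fin (length E)
  j = proj₁ s-in-E
  Eⱼ-in-D : Σ[ l ∈ Fin (length D) ] (∀ {p} → p ∈T lookup E j → p ∈T lookup D l)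
  Eⱼ-in-D = D.within-one-Triangle {lookup E j} (E.positive j) (λ p∈Eⱼ → E⊆D (lose (∈-lookup j) p∈Eⱼ))
  x₀ : Σ[ x ∈ Point ] x ∈T s
  x₀ = some-point s (D.positive i)
  i≡l : i ≡ proj₁ Eⱼ-in-D
  i≡l = D.shared-point-same-index (proj₂ x₀) (proj₂ Eⱼ-in-D (proj₂ s-in-E (proj₂ x₀)))
  s≡Eⱼ : s ≡ lookup E j
  s≡Eⱼ = Triangle-ext (D.positive i) (E.positive j) (proj₂ s-in-E)
           (λ p∈Eⱼ → subst (λ l → _ ∈T lookup D l) (sym i≡l) (proj₂ Eⱼ-in-D p∈Eⱼ))

lemma2 : (P : Pattern) → Unique P → P ≢ []
       → ∃[ L ] (Decomposition P L × (∀ L′ → Decomposition P L′ → L′ ↭ L))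
lemma2 P _ _ with decomposition P
... | L , d = L , d , λ L′ d′ →
  ∼bag⇒↭ (unique∧set⇒bag (proj₁ d′) (proj₁ d) (mk⇔ (⊆-decomposition d′ d) (⊆-decomposition d d′)))
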